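{- For every integer $n\ge 0$ and every integer $i$, $$\sum_k H_k(1;q){\begin{bmatrix} n\\ k\end{bmatrix}}_q A_{n-k,i-k}(q)-\sum_k H_k(1;q){\begin{bmatrix} n\\ k\end{bmatrix}}_q A_{n-k,i-2}(q)={\begin{bmatrix} n\\ i\end{bmatrix}}_q-{\begin{bmatrix} n\\ i-1\end{bmatrix}}_q+\begin{cases} H_n(1;q), & \text{if } i=1\neq n,\\ -H_n(1;q), & \text{if } i=n\neq 1,\\ 0, & \text{otherwise.}\end{cases}$$
   Context: For a positive integer $n$ let $(z;q)_n=\prod_{i=0}^{n-1}(1-zq^i)$, and $(z;q)_0=1$; $e(z;q)=\sum_{n\geq 0} z^n/(q;q)_n$. The $q$-Eulerian polynomials are defined by $\sum_{n\geq 0}A_n(t,q)\frac{z^n}{(q;q)_n}=\frac{e(z;q)-e(tz;q)}{e(tz;q)-t\,e(z;q)}$ and $A_n(t,q)=\sum_k A_{n,k}(q)t^k$, with $A_{n,k}(q)=0$ if $k<0$ or $k>n$ (note $A_{0,0}(q)=0$). The $q$-binomial coefficient is ${\begin{bmatrix} n\\ k\end{bmatrix}}_q=\frac{(q;q)_n}{(q;q)_{n-k}(q;q)_k}$ for $0\le k\le n$, and $0$ otherwise. The Rogers–Szegő polynomials are $H_n(t;q)=\sum_{i=0}^n{\begin{bmatrix} n\\ i\end{bmatrix}}_q t^i$. Sums over $k$ range over all integers (only finitely many terms are nonzero). -}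

module Defs where

open import Data.Nat as ℕ using (ℕ; zero; suc; _∸_; _<_; _≤?_)
open import Data.Nat.Divisibility using (_∣?_)
open import Data.Nat.Induction using (<-rec)
open import Data.Fin using (Fin; toℕ)
open import Data.Fin.Properties using (toℕ<n)
open import Data.Integer as ℤ using (ℤ; +_; -[1+_])
open import Relation.Nullary using (yes; no)
open import Relation.Binary.PropositionalEquality using (_≡_)

-- Formal power series in q with integer coefficients:
-- a series f stands for Σ_m f m · q^m.  All objects below (q-binomials,
-- Rogers–Szegő H_k(1;q), the coefficients A_{n,k}(q)) are polynomials in q,
-- and equality of polynomials is equality of all coefficients.

Series : Set
Series = ℕ → ℤ

0S : Series
0S _ = + 0

1S : Series
1S zero    = + 1
1S (suc _) = + 0

infixl 6 _⊕_ _⊖_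
infixl 7 _⊛_

_⊕_ : Series → Series → Series
(f ⊕ g) m = f m ℤ.+ g m

⊝_ : Series → Series
(⊝ f) m = ℤ.- f m

_⊖_ : Series → Series → Series
f ⊖ g = f ⊕ (⊝ g)

sumℤ : ℕ → (ℕ → ℤ) → ℤ
sumℤ zero    f = + 0
sumℤ (suc n) f = sumℤ n f ℤ.+ f n

_⊛_ : Series → Series → Series
(f ⊛ g) m = sumℤ (suc m) (λ j → f j ℤ.* g (m ∸ j))

sumS : ℕ → (ℕ → Series) → Series
sumS zero    f = 0S
sumS (suc n) f = sumS n f ⊕ f n

sumFin : (n : ℕ) → (Fin n → Series) → Series
sumFin zero    f = 0S
sumFin (suc n) f = f Fin.zero ⊕ sumFin n (λ j → f (Fin.suc j))

qpow : ℕ → Series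
qpow j m with j ℕ.≟ m
... | yes _ = + 1
... | no  _ = + 0

qPoch : ℕ → Series
qPoch zero    = 1S
qPoch (suc n) = qPoch n ⊛ (1S ⊖ qpow (suc n))

-- 1/(1 - q^j) = Σ_r q^{j r}  for j ≥ 1   (argument is j - 1)
geomInv : ℕ → Series
geomInv j m with suc j ∣? m
... | yes _ = + 1
... | no  _ = + 0

qPochInv : ℕ → Series
qPochInv zero    = 1S
qPochInv (suc n) = qPochInv n ⊛ geomInv n

qbinom : ℕ → ℕ → Series
qbinom n k with k ≤? n
... | yes _ = qPoch n ⊛ (qPochInv (n ∸ k) ⊛ qPochInv k)
... | no  _ = 0S

qbinomℤ : ℕ → ℤ → Series
qbinomℤ n (+ k)    = qbinom n k
qbinomℤ n -[1+ _ ] = 0S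

H1 : ℕ → Series
H1 n = sumS (suc n) (qbinom n)

-- Multiplying the defining identity
--   Σ_n A_n(t,q) z^n/(q;q)_n · (e(tz;q) - t e(z;q)) = e(z;q) - e(tz;q)
-- by (q;q)_n and comparing coefficients of z^n gives
--   (1 - t) A_n(t,q) = 1 - t^n - Σ_{j<n} [n j]_q A_j(t,q) (t^{n-j} - t),
-- which (1 - t being invertible in Z[q][[t]]) determines A_n uniquely:
--   A_{n,k} = Σ_{m=0}^{k} c_{n,m}   (k ≥ 0),   A_{n,k} = 0 (k < 0),
-- where c_{n,m} is the coefficient of t^m on the right-hand side.

δ0 : ℤ → Series
δ0 (+ zero)  = 1S
δ0 _         = 0S

δ : ℤ → ℕ → Series
δ k n with k ℤ.≟ + n
... | yes _ = 1S
... | no  _ = 0S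

AStep : (n : ℕ) → ((j : ℕ) → j < n → ℤ → Series) → ℤ → Series
AStep n rec = A'
  where
    c : ℤ → Series
    c m = (δ0 m ⊖ δ m n) ⊖
          sumFin n (λ j → qbinom n (toℕ j) ⊛
            (rec (toℕ j) (toℕ<n j) (m ℤ.- + (n ∸ toℕ j))
             ⊖ rec (toℕ j) (toℕ<n j) (m ℤ.- + 1)))
    A' : ℤ → Series
    A' (+ k)     = sumS (suc k) (λ m → c (+ m))
    A' -[1+ _ ]  = 0S

A : ℕ → ℤ → Series
A = <-rec (λ _ → ℤ → Series) (λ n rec → AStep n (λ j p → rec {j} p))

corr : ℕ → ℤ → Series
corr n i with n ℕ.≟ 1
... | yes _ = 0S
... | no  _ with i ℤ.≟ + 1 | i ℤ.≟ + n
...   | yes _ | _     = H1 n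
...   | no  _ | yes _ = ⊝ H1 n
...   | no  _ | no  _ = 0S

{-# OPTIONS --safe #-}
module Submission where

open import Defs
open import Data.Nat using (ℕ; suc; _∸_)
open import Data.Integer using (ℤ; +_; _-_)
open import Relation.Binary.PropositionalEquality using (_≡_)

open import Level using (0ℓ)
open import Function using (_∘_)
open import Data.Nat as ℕ using (zero; _≤_; _<_; s≤s; _≤?_)
import Data.Nat.Properties as ℕP
open import Data.Nat.Divisibility using (_∣_; _∣?_; _∣0; ∣⇒≤; ∣m+n∣m⇒∣n; ∣m∸n∣n⇒∣m; ∣-refl)
open import Data.Nat.Induction using (<-wellFounded)
open import Induction.WellFounded using (Acc; acc; acc-inverse; module Some)
open import Data.Fin using (Fin; toℕ)
open import Data.Fin.Properties using (toℕ<n)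
open import Data.Integer using (-[1+_]; _+_; _*_; -_)
import Data.Integer.Properties as ℤP
open import Data.Integer.Tactic.RingSolver using (solve-∀)
open import Relation.Binary.PropositionalEquality using (_≢_; refl; sym; trans; subst; cong; cong₂; module ≡-Reasoning)
open import Relation.Binary.Bundles using (Setoid)
open import Relation.Nullary using (Dec; yes; no)
import Data.Integer as ℤ
open import Data.Empty using (⊥-elim)

-- Comparing coefficients of z^N in the defining identity gives the recurrence
--   Σ_j [N j] (A_{j,i-N+j} - A_{j,i-1}) = [i = 0] - [i = N].
-- Since H_k(1;q) [n k] = Σ_a [n a] [n-a k-a], the left-hand side is the double
-- q-binomial sum Σ_a [n a] Σ_t [n-a t] (A_{n-a-t,i-a-t} - A_{n-a-t,i-2}).
-- Inserting ± A_{n-a-t,i-a-1} splits the inner sum into an instance of the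
-- recurrence plus a sum which, regrouped by the same identity, is the recurrence
-- at i - 1. What is left are the sums Σ_a [n a] [i = a] = [n i] and
-- Σ_a [n a] [i = n] = [i = n] H_n(1;q), and similarly at i - 1.

+-interchange : ∀ (a b c d : ℤ) → (a + b) + (c + d) ≡ (a + c) + (b + d)
+-interchange = solve-∀

sumℤ-cong : ∀ n {f g : ℕ → ℤ} → (∀ j → j < n → f j ≡ g j) → sumℤ n f ≡ sumℤ n g
sumℤ-cong zero    f≡g = refl
sumℤ-cong (suc n) f≡g =
  cong₂ _+_ (sumℤ-cong n (λ j j<n → f≡g j (ℕP.m<n⇒m<1+n j<n))) (f≡g n ℕP.≤-refl)

sumℤ-zero : ∀ n {f : ℕ → ℤ} → (∀ j → j < n → f j ≡ + 0) → sumℤ n f ≡ + 0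
sumℤ-zero zero    f≡0 = refl
sumℤ-zero (suc n) f≡0 =
  cong₂ _+_ (sumℤ-zero n (λ j j<n → f≡0 j (ℕP.m<n⇒m<1+n j<n))) (f≡0 n ℕP.≤-refl)

sumℤ-distrib-+ : ∀ n (f g : ℕ → ℤ) → sumℤ n (λ j → f j + g j) ≡ sumℤ n f + sumℤ n g
sumℤ-distrib-+ zero    f g = refl
sumℤ-distrib-+ (suc n) f g =
  trans (cong (_+ (f n + g n)) (sumℤ-distrib-+ n f g))
        (+-interchange (sumℤ n f) (sumℤ n g) (f n) (g n))

neg-sumℤ : ∀ n (f : ℕ → ℤ) → - sumℤ n f ≡ sumℤ n (λ j → - f j)
neg-sumℤ zero    f = refl
neg-sumℤ (suc n) f =
  trans (ℤP.neg-distrib-+ (sumℤ n f) (f n)) (cong (_+ - f n) (neg-sumℤ n f))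

*-distribˡ-sumℤ : ∀ n c (f : ℕ → ℤ) → c * sumℤ n f ≡ sumℤ n (λ j → c * f j)
*-distribˡ-sumℤ zero    c f = ℤP.*-zeroʳ c
*-distribˡ-sumℤ (suc n) c f =
  trans (ℤP.*-distribˡ-+ c (sumℤ n f) (f n)) (cong (_+ c * f n) (*-distribˡ-sumℤ n c f))

*-distribʳ-sumℤ : ∀ n c (f : ℕ → ℤ) → sumℤ n f * c ≡ sumℤ n (λ j → f j * c)
*-distribʳ-sumℤ zero    c f = refl
*-distribʳ-sumℤ (suc n) c f =
  trans (ℤP.*-distribʳ-+ c (sumℤ n f) (f n)) (cong (_+ f n * c) (*-distribʳ-sumℤ n c f))

sumℤ-head : ∀ n (f : ℕ → ℤ) → sumℤ (suc n) f ≡ f 0 + sumℤ n (f ∘ suc)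
sumℤ-head zero    f = ℤP.+-comm (+ 0) (f 0)
sumℤ-head (suc n) f =
  trans (cong (_+ f (suc n)) (sumℤ-head n f)) (ℤP.+-assoc (f 0) (sumℤ n (f ∘ suc)) (f (suc n)))

sumℤ-reverse : ∀ n (f : ℕ → ℤ) → sumℤ n f ≡ sumℤ n (λ j → f (n ∸ suc j))
sumℤ-reverse zero    f = refl
sumℤ-reverse (suc n) f =
  trans (cong (_+ f n) (sumℤ-reverse n f))
        (trans (ℤP.+-comm _ (f n)) (sym (sumℤ-head n (λ j → f (n ∸ j)))))

sumℤ-single : ∀ n s {f : ℕ → ℤ} → s < n → (∀ j → j < n → j ≢ s → f j ≡ + 0) →
              sumℤ n f ≡ f s
sumℤ-single (suc n) s {f} s<1+n f≡0 with s ℕ.≟ n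
... | yes refl =
  trans (cong (_+ f s) (sumℤ-zero s (λ j j<s → f≡0 j (ℕP.m<n⇒m<1+n j<s) (ℕP.<⇒≢ j<s))))
        (ℤP.+-identityˡ (f s))
... | no s≢n =
  trans (cong₂ _+_ (sumℤ-single n s (ℕP.≤∧≢⇒< (ℕP.≤-pred s<1+n) s≢n)
                                    (λ j j<n → f≡0 j (ℕP.m<n⇒m<1+n j<n)))
                   (f≡0 n ℕP.≤-refl (s≢n ∘ sym)))
        (ℤP.+-identityʳ (f s))

sumℤ-triangle : ∀ M (F : ℕ → ℕ → ℤ) →
  sumℤ M (λ j → sumℤ (suc j) (λ l → F l j)) ≡ sumℤ M (λ l → sumℤ (M ∸ l) (λ t → F l (l ℕ.+ t)))
sumℤ-triangle zero    F = refl
sumℤ-triangle (suc M) F = begin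
    sumℤ M (λ j → sumℤ (suc j) (λ l → F l j)) + sumℤ (suc M) (λ l → F l M)
  ≡⟨ cong (_+ sumℤ (suc M) (λ l → F l M)) (sumℤ-triangle M F) ⟩
    sumℤ M rows + sumℤ (suc M) (λ l → F l M)
  ≡⟨ cong (_+ sumℤ (suc M) (λ l → F l M))
          (trans (sym (ℤP.+-identityʳ (sumℤ M rows))) (cong (λ x → sumℤ M rows + x) (sym empty-row))) ⟩
    sumℤ (suc M) rows + sumℤ (suc M) (λ l → F l M)
  ≡⟨ sym (sumℤ-distrib-+ (suc M) rows (λ l → F l M)) ⟩
    sumℤ (suc M) (λ l → rows l + F l M)
  ≡⟨ sumℤ-cong (suc M) extend-row ⟩
    sumℤ (suc M) (λ l → sumℤ (suc M ∸ l) (λ t → F l (l ℕ.+ t)))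
  ∎
  where
  open ≡-Reasoning
  rows : ℕ → ℤ
  rows l = sumℤ (M ∸ l) (λ t → F l (l ℕ.+ t))
  empty-row : rows M ≡ + 0
  empty-row = cong (λ k → sumℤ k (λ t → F M (M ℕ.+ t))) (ℕP.n∸n≡0 M)
  extend-row : ∀ l → l < suc M → rows l + F l M ≡ sumℤ (suc M ∸ l) (λ t → F l (l ℕ.+ t))
  extend-row l (s≤s l≤M) rewrite ℕP.+-∸-assoc 1 l≤M =
    cong (λ k → rows l + F l k) (sym (ℕP.m+[n∸m]≡n l≤M))

infix 4 _≈_
record _≈_ (f g : Series) : Set where
  constructor coeffwise
  field coeff : ∀ m → f m ≡ g m
open _≈_ public

≈-refl : ∀ {f} → f ≈ f
≈-refl = coeffwise λ _ → refl

≈-sym : ∀ {f g} → f ≈ g → g ≈ f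
≈-sym f≈g = coeffwise λ m → sym (coeff f≈g m)

≈-trans : ∀ {f g h} → f ≈ g → g ≈ h → f ≈ h
≈-trans f≈g g≈h = coeffwise λ m → trans (coeff f≈g m) (coeff g≈h m)

≡⇒≈ : ∀ {f g} → f ≡ g → f ≈ g
≡⇒≈ refl = ≈-refl

Series-setoid : Setoid 0ℓ 0ℓ
Series-setoid = record
  { Carrier = Series ; _≈_ = _≈_
  ; isEquivalence = record { refl = ≈-refl ; sym = ≈-sym ; trans = ≈-trans } }


⊕-cong : ∀ {f f′ g g′} → f ≈ f′ → g ≈ g′ → f ⊕ g ≈ f′ ⊕ g′
⊕-cong f≈f′ g≈g′ = coeffwise λ m → cong₂ _+_ (coeff f≈f′ m) (coeff g≈g′ m)

⊖-cong : ∀ {f f′ g g′} → f ≈ f′ → g ≈ g′ → f ⊖ g ≈ f′ ⊖ g′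
⊖-cong f≈f′ g≈g′ = coeffwise λ m → cong₂ (λ x y → x + - y) (coeff f≈f′ m) (coeff g≈g′ m)

⊛-cong : ∀ {f f′ g g′} → f ≈ f′ → g ≈ g′ → f ⊛ g ≈ f′ ⊛ g′
⊛-cong f≈f′ g≈g′ = coeffwise λ m →
  sumℤ-cong (suc m) (λ j _ → cong₂ _*_ (coeff f≈f′ j) (coeff g≈g′ (m ∸ j)))

⊛-congˡ : ∀ f {g g′} → g ≈ g′ → f ⊛ g ≈ f ⊛ g′
⊛-congˡ f = ⊛-cong (≈-refl {f})

⊛-congʳ : ∀ g {f f′} → f ≈ f′ → f ⊛ g ≈ f′ ⊛ g
⊛-congʳ g f≈f′ = ⊛-cong f≈f′ (≈-refl {g})

⊛-comm : ∀ f g → f ⊛ g ≈ g ⊛ f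
⊛-comm f g = coeffwise λ m → trans (sumℤ-reverse (suc m) _) (sumℤ-cong (suc m) λ j j≤m →
  trans (ℤP.*-comm (f (m ∸ j)) (g (m ∸ (m ∸ j))))
        (cong (λ k → g k * f (m ∸ j)) (ℕP.m∸[m∸n]≡n (ℕP.≤-pred j≤m))))

⊛-assoc : ∀ f g h → (f ⊛ g) ⊛ h ≈ f ⊛ (g ⊛ h)
⊛-assoc f g h = coeffwise assoc-at
  where
  open ≡-Reasoning
  row : ∀ m l → l < suc m →
        sumℤ (suc m ∸ l) (λ t → f l * g (l ℕ.+ t ∸ l) * h (m ∸ (l ℕ.+ t)))
        ≡ f l * sumℤ (suc (m ∸ l)) (λ t → g t * h (m ∸ l ∸ t))
  row m l (s≤s l≤m) rewrite ℕP.+-∸-assoc 1 l≤m =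
    trans (sumℤ-cong (suc (m ∸ l)) (λ t _ →
             trans (ℤP.*-assoc (f l) _ _)
                   (cong₂ (λ a b → f l * (g a * h b)) (ℕP.m+n∸m≡n l t) (sym (ℕP.∸-+-assoc m l t)))))
          (sym (*-distribˡ-sumℤ (suc (m ∸ l)) (f l) _))
  assoc-at : ∀ m → ((f ⊛ g) ⊛ h) m ≡ (f ⊛ (g ⊛ h)) m
  assoc-at m = begin
      sumℤ (suc m) (λ j → sumℤ (suc j) (λ l → f l * g (j ∸ l)) * h (m ∸ j))
    ≡⟨ sumℤ-cong (suc m) (λ j _ → *-distribʳ-sumℤ (suc j) (h (m ∸ j)) _) ⟩
      sumℤ (suc m) (λ j → sumℤ (suc j) (λ l → f l * g (j ∸ l) * h (m ∸ j)))
    ≡⟨ sumℤ-triangle (suc m) (λ l j → f l * g (j ∸ l) * h (m ∸ j)) ⟩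
      sumℤ (suc m) (λ l → sumℤ (suc m ∸ l) (λ t → f l * g (l ℕ.+ t ∸ l) * h (m ∸ (l ℕ.+ t))))
    ≡⟨ sumℤ-cong (suc m) (row m) ⟩
      sumℤ (suc m) (λ l → f l * sumℤ (suc (m ∸ l)) (λ t → g t * h (m ∸ l ∸ t)))
    ∎

⊛-distribʳ : ∀ h f g → (f ⊕ g) ⊛ h ≈ (f ⊛ h) ⊕ (g ⊛ h)
⊛-distribʳ h f g = coeffwise λ m →
  trans (sumℤ-cong (suc m) (λ j _ → ℤP.*-distribʳ-+ (h (m ∸ j)) (f j) (g j)))
        (sumℤ-distrib-+ (suc m) _ _)

⊛-negˡ : ∀ f h → (⊝ f) ⊛ h ≈ ⊝ (f ⊛ h)
⊛-negˡ f h = coeffwise λ m →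
  trans (sumℤ-cong (suc m) (λ j _ → sym (ℤP.neg-distribˡ-* (f j) (h (m ∸ j)))))
        (sym (neg-sumℤ (suc m) _))

⊛-distribʳ-⊖ : ∀ h f g → (f ⊖ g) ⊛ h ≈ (f ⊛ h) ⊖ (g ⊛ h)
⊛-distribʳ-⊖ h f g = ≈-trans (⊛-distribʳ h f (⊝ g)) (⊕-cong (≈-refl {f ⊛ h}) (⊛-negˡ g h))

⊛-distribˡ : ∀ h f g → h ⊛ (f ⊕ g) ≈ (h ⊛ f) ⊕ (h ⊛ g)
⊛-distribˡ h f g =
  ≈-trans (⊛-comm h (f ⊕ g)) (≈-trans (⊛-distribʳ h f g) (⊕-cong (⊛-comm f h) (⊛-comm g h)))

⊛-distribˡ-⊖ : ∀ h f g → h ⊛ (f ⊖ g) ≈ (h ⊛ f) ⊖ (h ⊛ g)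
⊛-distribˡ-⊖ h f g =
  ≈-trans (⊛-comm h (f ⊖ g)) (≈-trans (⊛-distribʳ-⊖ h f g) (⊖-cong (⊛-comm f h) (⊛-comm g h)))

⊛-zeroʳ : ∀ f → f ⊛ 0S ≈ 0S
⊛-zeroʳ f = coeffwise λ m → sumℤ-zero (suc m) (λ j _ → ℤP.*-zeroʳ (f j))

⊛-identityˡ : ∀ f → 1S ⊛ f ≈ f
⊛-identityˡ f = coeffwise λ m →
  trans (sumℤ-head m _)
        (trans (cong₂ _+_ (ℤP.*-identityˡ (f m)) (sumℤ-zero m (λ _ _ → refl))) (ℤP.+-identityʳ (f m)))

⊛-identityʳ : ∀ f → f ⊛ 1S ≈ f
⊛-identityʳ f = ≈-trans (⊛-comm f 1S) (⊛-identityˡ f)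

open import Relation.Binary.Reasoning.Setoid Series-setoid

⊛-interchange : ∀ a b c d → (a ⊛ b) ⊛ (c ⊛ d) ≈ (a ⊛ c) ⊛ (b ⊛ d)
⊛-interchange a b c d = begin
    (a ⊛ b) ⊛ (c ⊛ d)   ≈⟨ ⊛-assoc a b (c ⊛ d) ⟩
    a ⊛ (b ⊛ (c ⊛ d))   ≈⟨ ⊛-congˡ a (≈-sym (⊛-assoc b c d)) ⟩
    a ⊛ ((b ⊛ c) ⊛ d)   ≈⟨ ⊛-congˡ a (⊛-congʳ d (⊛-comm b c)) ⟩
    a ⊛ ((c ⊛ b) ⊛ d)   ≈⟨ ⊛-congˡ a (⊛-assoc c b d) ⟩
    a ⊛ (c ⊛ (b ⊛ d))   ≈⟨ ≈-sym (⊛-assoc a c (b ⊛ d)) ⟩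
    (a ⊛ c) ⊛ (b ⊛ d)   ∎

⊛-cancel-middle : ∀ p x y z w → y ⊛ z ≈ 1S → (p ⊛ (x ⊛ y)) ⊛ (z ⊛ w) ≈ p ⊛ (x ⊛ w)
⊛-cancel-middle p x y z w yz≈1 = begin
    (p ⊛ (x ⊛ y)) ⊛ (z ⊛ w)   ≈⟨ ⊛-assoc p (x ⊛ y) (z ⊛ w) ⟩
    p ⊛ ((x ⊛ y) ⊛ (z ⊛ w))   ≈⟨ ⊛-congˡ p (⊛-assoc x y (z ⊛ w)) ⟩
    p ⊛ (x ⊛ (y ⊛ (z ⊛ w)))   ≈⟨ ⊛-congˡ p (⊛-congˡ x (≈-sym (⊛-assoc y z w))) ⟩
    p ⊛ (x ⊛ ((y ⊛ z) ⊛ w))   ≈⟨ ⊛-congˡ p (⊛-congˡ x (⊛-congʳ w yz≈1)) ⟩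
    p ⊛ (x ⊛ (1S ⊛ w))        ≈⟨ ⊛-congˡ p (⊛-congˡ x (⊛-identityˡ w)) ⟩
    p ⊛ (x ⊛ w)               ∎

sumS-coeff : ∀ n (F : ℕ → Series) m → sumS n F m ≡ sumℤ n (λ j → F j m)
sumS-coeff zero    F m = refl
sumS-coeff (suc n) F m = cong (_+ F n m) (sumS-coeff n F m)

sumS-cong : ∀ n {F G : ℕ → Series} → (∀ j → j < n → F j ≈ G j) → sumS n F ≈ sumS n G
sumS-cong zero    F≈G = ≈-refl
sumS-cong (suc n) F≈G =
  ⊕-cong (sumS-cong n (λ j j<n → F≈G j (ℕP.m<n⇒m<1+n j<n))) (F≈G n ℕP.≤-refl)

sumS-zero : ∀ n {F : ℕ → Series} → (∀ j → j < n → F j ≈ 0S) → sumS n F ≈ 0S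
sumS-zero n {F} F≈0 = coeffwise λ m →
  trans (sumS-coeff n F m) (sumℤ-zero n (λ j j<n → coeff (F≈0 j j<n) m))

sumS-distrib-⊕ : ∀ n (F G : ℕ → Series) → sumS n (λ j → F j ⊕ G j) ≈ sumS n F ⊕ sumS n G
sumS-distrib-⊕ zero    F G = coeffwise λ _ → refl
sumS-distrib-⊕ (suc n) F G = coeffwise λ m →
  trans (cong (_+ (F n m + G n m)) (coeff (sumS-distrib-⊕ n F G) m))
        (+-interchange (sumS n F m) (sumS n G m) (F n m) (G n m))

sumS-distrib-⊖ : ∀ n (F G : ℕ → Series) → sumS n (λ j → F j ⊖ G j) ≈ sumS n F ⊖ sumS n G
sumS-distrib-⊖ n F G = ≈-trans (sumS-distrib-⊕ n F (λ j → ⊝ G j)) (coeffwise λ m →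
  cong (λ x → sumS n F m + x) (trans (sumS-coeff n (λ j → ⊝ G j) m)
                              (trans (sym (neg-sumℤ n (λ j → G j m))) (cong -_ (sym (sumS-coeff n G m))))))

⊛-distribʳ-sumS : ∀ g n (F : ℕ → Series) → sumS n F ⊛ g ≈ sumS n (λ j → F j ⊛ g)
⊛-distribʳ-sumS g zero    F = ≈-trans (⊛-comm 0S g) (⊛-zeroʳ g)
⊛-distribʳ-sumS g (suc n) F =
  ≈-trans (⊛-distribʳ g (sumS n F) (F n)) (⊕-cong (⊛-distribʳ-sumS g n F) (≈-refl {F n ⊛ g}))

⊛-distribˡ-sumS : ∀ g n (F : ℕ → Series) → g ⊛ sumS n F ≈ sumS n (λ j → g ⊛ F j)
⊛-distribˡ-sumS g n F = ≈-trans (⊛-comm g (sumS n F))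
  (≈-trans (⊛-distribʳ-sumS g n F) (sumS-cong n (λ j _ → ⊛-comm (F j) g)))

sumS-head : ∀ n (F : ℕ → Series) → sumS (suc n) F ≈ F 0 ⊕ sumS n (F ∘ suc)
sumS-head n F = coeffwise λ m → trans (sumS-coeff (suc n) F m)
  (trans (sumℤ-head n (λ j → F j m)) (cong (λ x → F 0 m + x) (sym (sumS-coeff n (F ∘ suc) m))))

sumS-single : ∀ n s {F : ℕ → Series} → s < n → (∀ j → j < n → j ≢ s → F j ≈ 0S) → sumS n F ≈ F s
sumS-single n s {F} s<n F≈0 = coeffwise λ m →
  trans (sumS-coeff n F m) (sumℤ-single n s s<n (λ j j<n j≢s → coeff (F≈0 j j<n j≢s) m))

sumS-reverse : ∀ n (F : ℕ → Series) → sumS n F ≈ sumS n (λ j → F (n ∸ suc j))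
sumS-reverse n F = coeffwise λ m →
  trans (sumS-coeff n F m) (trans (sumℤ-reverse n _) (sym (sumS-coeff n _ m)))

sumS-triangle : ∀ M (F : ℕ → ℕ → Series) →
  sumS M (λ j → sumS (suc j) (λ l → F l j)) ≈ sumS M (λ l → sumS (M ∸ l) (λ t → F l (l ℕ.+ t)))
sumS-triangle M F = coeffwise λ m →
  trans (sumS-coeff M _ m)
  (trans (sumℤ-cong M (λ j _ → sumS-coeff (suc j) (λ l → F l j) m))
  (trans (sumℤ-triangle M (λ l j → F l j m))
         (sym (trans (sumS-coeff M _ m) (sumℤ-cong M (λ l _ → sumS-coeff (M ∸ l) _ m))))))

sumFin-cong : ∀ n {F G : Fin n → Series} → (∀ j → F j ≈ G j) → sumFin n F ≈ sumFin n G
sumFin-cong zero    F≈G = ≈-refl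
sumFin-cong (suc n) F≈G = ⊕-cong (F≈G Fin.zero) (sumFin-cong n (F≈G ∘ Fin.suc))

sumFin-toℕ : ∀ n (F : ℕ → Series) → sumFin n (F ∘ toℕ) ≈ sumS n F
sumFin-toℕ zero    F = ≈-refl
sumFin-toℕ (suc n) F =
  ≈-trans (⊕-cong (≈-refl {F 0}) (sumFin-toℕ n (F ∘ suc))) (≈-sym (sumS-head n F))

qpow-diag : ∀ d → qpow d d ≡ + 1
qpow-diag d with d ℕ.≟ d
... | yes _   = refl
... | no  d≢d = ⊥-elim (d≢d refl)

qpow-≢ : ∀ d j → d ≢ j → qpow d j ≡ + 0
qpow-≢ d j d≢j with d ℕ.≟ j
... | yes d≡j = ⊥-elim (d≢j d≡j)
... | no  _   = refl

qpow-⊛-≤ : ∀ d g {m} → d ≤ m → (qpow d ⊛ g) m ≡ g (m ∸ d)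
qpow-⊛-≤ d g {m} d≤m =
  trans (sumℤ-single (suc m) d (s≤s d≤m)
          (λ j _ j≢d → cong (_* g (m ∸ j)) (qpow-≢ d j (j≢d ∘ sym))))
        (trans (cong (_* g (m ∸ d)) (qpow-diag d)) (ℤP.*-identityˡ (g (m ∸ d))))

qpow-⊛-> : ∀ d g {m} → m < d → (qpow d ⊛ g) m ≡ + 0
qpow-⊛-> d g {m} m<d = sumℤ-zero (suc m) (λ j j≤m →
  cong (_* g (m ∸ j)) (qpow-≢ d j (λ d≡j → ℕP.<-irrefl (sym d≡j) (ℕP.≤-trans j≤m m<d))))

geomInv-periodic : ∀ j {m} → suc j ≤ m → geomInv j m ≡ geomInv j (m ∸ suc j)
geomInv-periodic j {m} d≤m with suc j ∣? m | suc j ∣? (m ∸ suc j)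
... | yes _   | yes _    = refl
... | no  _   | no  _    = refl
... | yes d∣m | no  d∤m′ =
  ⊥-elim (d∤m′ (∣m+n∣m⇒∣n (subst (suc j ∣_) (sym (ℕP.m+[n∸m]≡n d≤m)) d∣m) ∣-refl))
... | no  d∤m | yes d∣m′ = ⊥-elim (d∤m (∣m∸n∣n⇒∣m (suc j) d≤m d∣m′ ∣-refl))

geomInv-below : ∀ j {m} → m < suc j → geomInv j m ≡ 1S m
geomInv-below j {zero} _ with suc j ∣? 0
... | yes _   = refl
... | no  d∤0 = ⊥-elim (d∤0 (suc j ∣0))
geomInv-below j {suc m} m<d with suc j ∣? suc m
... | yes d∣m = ⊥-elim (ℕP.<-irrefl refl (ℕP.≤-trans m<d (∣⇒≤ d∣m)))
... | no  _   = refl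

geomInv-inverse : ∀ j → (1S ⊖ qpow (suc j)) ⊛ geomInv j ≈ 1S
geomInv-inverse j = ≈-trans (⊛-distribʳ-⊖ (geomInv j) 1S (qpow (suc j)))
  (≈-trans (⊖-cong (⊛-identityˡ (geomInv j)) ≈-refl) (coeffwise coeff-inverse))
  where
  coeff-inverse : ∀ m → geomInv j m + - (qpow (suc j) ⊛ geomInv j) m ≡ 1S m
  coeff-inverse m with suc j ≤? m
  coeff-inverse zero    | yes ()
  coeff-inverse m       | no  d≰m =
    trans (cong (λ x → geomInv j m + - x) (qpow-⊛-> (suc j) (geomInv j) (ℕP.≰⇒> d≰m)))
          (trans (ℤP.+-identityʳ (geomInv j m)) (geomInv-below j (ℕP.≰⇒> d≰m)))
  coeff-inverse (suc m) | yes d≤m =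
    trans (cong₂ (λ x y → x + - y) (geomInv-periodic j d≤m) (qpow-⊛-≤ (suc j) (geomInv j) d≤m))
          (ℤP.+-inverseʳ (geomInv j (suc m ∸ suc j)))

qPoch-inverse : ∀ n → qPoch n ⊛ qPochInv n ≈ 1S
qPoch-inverse zero    = ⊛-identityˡ 1S
qPoch-inverse (suc n) = begin
    (qPoch n ⊛ (1S ⊖ qpow (suc n))) ⊛ (qPochInv n ⊛ geomInv n)
  ≈⟨ ⊛-interchange (qPoch n) (1S ⊖ qpow (suc n)) (qPochInv n) (geomInv n) ⟩
    (qPoch n ⊛ qPochInv n) ⊛ ((1S ⊖ qpow (suc n)) ⊛ geomInv n)
  ≈⟨ ⊛-cong (qPoch-inverse n) (geomInv-inverse n) ⟩
    1S ⊛ 1S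
  ≈⟨ ⊛-identityˡ 1S ⟩
    1S
  ∎

qbinom-≤ : ∀ {n k} → k ≤ n → qbinom n k ≈ qPoch n ⊛ (qPochInv (n ∸ k) ⊛ qPochInv k)
qbinom-≤ {n} {k} k≤n with k ≤? n
... | yes _   = ≈-refl
... | no  k≰n = ⊥-elim (k≰n k≤n)

qbinom-> : ∀ {n k} → n < k → qbinom n k ≈ 0S
qbinom-> {n} {k} n<k with k ≤? n
... | yes k≤n = ⊥-elim (ℕP.<⇒≱ n<k k≤n)
... | no  _   = ≈-refl

qbinom-diag : ∀ n → qbinom n n ≈ 1S
qbinom-diag n = begin
    qbinom n n                                  ≈⟨ qbinom-≤ {n} ℕP.≤-refl ⟩
    qPoch n ⊛ (qPochInv (n ∸ n) ⊛ qPochInv n)  ≈⟨ ⊛-congˡ (qPoch n) (⊛-congʳ (qPochInv n) n∸n) ⟩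
    qPoch n ⊛ (1S ⊛ qPochInv n)                 ≈⟨ ⊛-congˡ (qPoch n) (⊛-identityˡ (qPochInv n)) ⟩
    qPoch n ⊛ qPochInv n                        ≈⟨ qPoch-inverse n ⟩
    1S                                          ∎
  where
  n∸n : qPochInv (n ∸ n) ≈ qPochInv 0
  n∸n = ≡⇒≈ (cong qPochInv (ℕP.n∸n≡0 n))

qbinom-symmetric : ∀ {n k} → k ≤ n → qbinom n (n ∸ k) ≈ qbinom n k
qbinom-symmetric {n} {k} k≤n = begin
    qbinom n (n ∸ k)
  ≈⟨ qbinom-≤ (ℕP.m∸n≤m n k) ⟩
    qPoch n ⊛ (qPochInv (n ∸ (n ∸ k)) ⊛ qPochInv (n ∸ k))
  ≈⟨ ⊛-congˡ (qPoch n) (⊛-congʳ (qPochInv (n ∸ k)) (≡⇒≈ (cong qPochInv (ℕP.m∸[m∸n]≡n k≤n)))) ⟩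
    qPoch n ⊛ (qPochInv k ⊛ qPochInv (n ∸ k))
  ≈⟨ ⊛-congˡ (qPoch n) (⊛-comm (qPochInv k) (qPochInv (n ∸ k))) ⟩
    qPoch n ⊛ (qPochInv (n ∸ k) ⊛ qPochInv k)
  ≈⟨ ≈-sym (qbinom-≤ k≤n) ⟩
    qbinom n k
  ∎

qbinom-⊛-qbinom-trinomial : ∀ {n k a} → a ≤ k → k ≤ n →
  qbinom n k ⊛ qbinom k a ≈ qPoch n ⊛ (qPochInv (n ∸ k) ⊛ (qPochInv (k ∸ a) ⊛ qPochInv a))
qbinom-⊛-qbinom-trinomial {n} {k} {a} a≤k k≤n =
  ≈-trans (⊛-cong (qbinom-≤ k≤n) (qbinom-≤ a≤k))
          (⊛-cancel-middle (qPoch n) (qPochInv (n ∸ k)) (qPochInv k) (qPoch k) (qPochInv (k ∸ a) ⊛ qPochInv a)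
                           (≈-trans (⊛-comm (qPochInv k) (qPoch k)) (qPoch-inverse k)))

m∸n∸[o∸n]≡m∸o : ∀ m {n o} → n ≤ o → m ∸ n ∸ (o ∸ n) ≡ m ∸ o
m∸n∸[o∸n]≡m∸o m {n} {o} n≤o =
  trans (ℕP.∸-+-assoc m n (o ∸ n)) (cong (m ∸_) (ℕP.m+[n∸m]≡n n≤o))

qbinom-⊛-qbinom : ∀ {n k a} → a ≤ k → k ≤ n →
  qbinom n k ⊛ qbinom k a ≈ qbinom n a ⊛ qbinom (n ∸ a) (k ∸ a)
qbinom-⊛-qbinom {n} {k} {a} a≤k k≤n = begin
    qbinom n k ⊛ qbinom k a
  ≈⟨ qbinom-⊛-qbinom-trinomial a≤k k≤n ⟩
    qPoch n ⊛ (qPochInv (n ∸ k) ⊛ (qPochInv (k ∸ a) ⊛ qPochInv a))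
  ≈⟨ ⊛-congˡ (qPoch n) rotate ⟩
    qPoch n ⊛ (qPochInv (n ∸ (n ∸ a)) ⊛ (qPochInv (n ∸ a ∸ (k ∸ a)) ⊛ qPochInv (k ∸ a)))
  ≈⟨ ≈-sym (qbinom-⊛-qbinom-trinomial (ℕP.∸-monoˡ-≤ a k≤n) (ℕP.m∸n≤m n a)) ⟩
    qbinom n (n ∸ a) ⊛ qbinom (n ∸ a) (k ∸ a)
  ≈⟨ ⊛-congʳ (qbinom (n ∸ a) (k ∸ a)) (qbinom-symmetric a≤n) ⟩
    qbinom n a ⊛ qbinom (n ∸ a) (k ∸ a)
  ∎
  where
  a≤n : a ≤ n
  a≤n = ℕP.≤-trans a≤k k≤n
  rotate : qPochInv (n ∸ k) ⊛ (qPochInv (k ∸ a) ⊛ qPochInv a)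
         ≈ qPochInv (n ∸ (n ∸ a)) ⊛ (qPochInv (n ∸ a ∸ (k ∸ a)) ⊛ qPochInv (k ∸ a))
  rotate = begin
      qPochInv (n ∸ k) ⊛ (qPochInv (k ∸ a) ⊛ qPochInv a)
    ≈⟨ ≈-sym (⊛-assoc (qPochInv (n ∸ k)) (qPochInv (k ∸ a)) (qPochInv a)) ⟩
      (qPochInv (n ∸ k) ⊛ qPochInv (k ∸ a)) ⊛ qPochInv a
    ≈⟨ ⊛-comm (qPochInv (n ∸ k) ⊛ qPochInv (k ∸ a)) (qPochInv a) ⟩
      qPochInv a ⊛ (qPochInv (n ∸ k) ⊛ qPochInv (k ∸ a))
    ≈⟨ ≡⇒≈ (cong₂ (λ u v → qPochInv u ⊛ (qPochInv v ⊛ qPochInv (k ∸ a)))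
                  (sym (ℕP.m∸[m∸n]≡n a≤n)) (sym (m∸n∸[o∸n]≡m∸o n a≤k))) ⟩
      qPochInv (n ∸ (n ∸ a)) ⊛ (qPochInv (n ∸ a ∸ (k ∸ a)) ⊛ qPochInv (k ∸ a))
    ∎

qbinomSum : ℕ → (ℕ → Series) → Series
qbinomSum n f = sumS (suc n) (λ k → qbinom n k ⊛ f k)

qbinomSum-cong : ∀ n {f g} → (∀ k → k ≤ n → f k ≈ g k) → qbinomSum n f ≈ qbinomSum n g
qbinomSum-cong n f≈g =
  sumS-cong (suc n) (λ k k<1+n → ⊛-congˡ (qbinom n k) (f≈g k (ℕP.≤-pred k<1+n)))

qbinomSum-distrib-⊕ : ∀ n f g → qbinomSum n (λ k → f k ⊕ g k) ≈ qbinomSum n f ⊕ qbinomSum n g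
qbinomSum-distrib-⊕ n f g = ≈-trans
  (sumS-cong (suc n) (λ k _ → ⊛-distribˡ (qbinom n k) (f k) (g k))) (sumS-distrib-⊕ (suc n) _ _)

qbinomSum-distrib-⊖ : ∀ n f g → qbinomSum n (λ k → f k ⊖ g k) ≈ qbinomSum n f ⊖ qbinomSum n g
qbinomSum-distrib-⊖ n f g = ≈-trans
  (sumS-cong (suc n) (λ k _ → ⊛-distribˡ-⊖ (qbinom n k) (f k) (g k))) (sumS-distrib-⊖ (suc n) _ _)

qbinomSum-const : ∀ n c → qbinomSum n (λ _ → c) ≈ H1 n ⊛ c
qbinomSum-const n c = ≈-sym (⊛-distribʳ-sumS c (suc n) (qbinom n))

qbinomSum-reverse : ∀ n (g : ℕ → ℕ → Series) →
  qbinomSum n (λ t → g (n ∸ t) t) ≈ qbinomSum n (λ j → g j (n ∸ j))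
qbinomSum-reverse n g = ≈-trans (sumS-reverse (suc n) _) (sumS-cong (suc n) λ j j<1+n →
  ⊛-cong (qbinom-symmetric (ℕP.≤-pred j<1+n))
         (≡⇒≈ (cong (λ k → g k (n ∸ j)) (ℕP.m∸[m∸n]≡n (ℕP.≤-pred j<1+n)))))

qbinomSum-nested : ∀ n (f : ℕ → ℕ → Series) →
  qbinomSum n (λ k → qbinomSum k (λ a → f a (k ∸ a))) ≈ qbinomSum n (λ a → qbinomSum (n ∸ a) (f a))
qbinomSum-nested n f = begin
    qbinomSum n (λ k → qbinomSum k (λ a → f a (k ∸ a)))
  ≈⟨ sumS-cong (suc n) (λ k k<1+n → ≈-trans (⊛-distribˡ-sumS (qbinom n k) (suc k) _)
       (sumS-cong (suc k) (λ a a<1+k → regroup (ℕP.≤-pred a<1+k) (ℕP.≤-pred k<1+n)))) ⟩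
    sumS (suc n) (λ k → sumS (suc k) (λ a → G a k))
  ≈⟨ sumS-triangle (suc n) G ⟩
    sumS (suc n) (λ a → sumS (suc n ∸ a) (λ t → G a (a ℕ.+ t)))
  ≈⟨ sumS-cong (suc n) (λ a a<1+n → row (ℕP.≤-pred a<1+n)) ⟩
    qbinomSum n (λ a → qbinomSum (n ∸ a) (f a))
  ∎
  where
  G : ℕ → ℕ → Series
  G a k = qbinom n a ⊛ (qbinom (n ∸ a) (k ∸ a) ⊛ f a (k ∸ a))
  regroup : ∀ {a k} → a ≤ k → k ≤ n → qbinom n k ⊛ (qbinom k a ⊛ f a (k ∸ a)) ≈ G a k
  regroup {a} {k} a≤k k≤n = begin
      qbinom n k ⊛ (qbinom k a ⊛ f a (k ∸ a))
    ≈⟨ ≈-sym (⊛-assoc (qbinom n k) (qbinom k a) (f a (k ∸ a))) ⟩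
      (qbinom n k ⊛ qbinom k a) ⊛ f a (k ∸ a)
    ≈⟨ ⊛-congʳ (f a (k ∸ a)) (qbinom-⊛-qbinom a≤k k≤n) ⟩
      (qbinom n a ⊛ qbinom (n ∸ a) (k ∸ a)) ⊛ f a (k ∸ a)
    ≈⟨ ⊛-assoc (qbinom n a) (qbinom (n ∸ a) (k ∸ a)) (f a (k ∸ a)) ⟩
      G a k
    ∎
  row : ∀ {a} → a ≤ n →
        sumS (suc n ∸ a) (λ t → G a (a ℕ.+ t)) ≈ qbinom n a ⊛ qbinomSum (n ∸ a) (f a)
  row {a} a≤n = begin
      sumS (suc n ∸ a) (λ t → G a (a ℕ.+ t))
    ≈⟨ ≡⇒≈ (cong (λ l → sumS l (λ t → G a (a ℕ.+ t))) (ℕP.+-∸-assoc 1 a≤n)) ⟩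
      sumS (suc (n ∸ a)) (λ t → G a (a ℕ.+ t))
    ≈⟨ sumS-cong (suc (n ∸ a)) (λ t _ →
         ≡⇒≈ (cong (λ u → qbinom n a ⊛ (qbinom (n ∸ a) u ⊛ f a u)) (ℕP.m+n∸m≡n a t))) ⟩
      sumS (suc (n ∸ a)) (λ t → qbinom n a ⊛ (qbinom (n ∸ a) t ⊛ f a t))
    ≈⟨ ≈-sym (⊛-distribˡ-sumS (qbinom n a) (suc (n ∸ a)) _) ⟩
      qbinom n a ⊛ qbinomSum (n ∸ a) (f a)
    ∎

AStep-cong : ∀ n {rec rec′ : (j : ℕ) → j < n → ℤ → Series} →
  (∀ j j<n x → rec j j<n x ≈ rec′ j j<n x) → ∀ x → AStep n rec x ≈ AStep n rec′ x
AStep-cong n rec≈rec′ (+ k)    = sumS-cong (suc k) λ m _ →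
  ⊖-cong (≈-refl {δ0 (+ m) ⊖ δ (+ m) n}) (sumFin-cong n λ j → ⊛-congˡ (qbinom n (toℕ j))
    (⊖-cong (rec≈rec′ (toℕ j) (toℕ<n j) (+ m - + (n ∸ toℕ j)))
            (rec≈rec′ (toℕ j) (toℕ<n j) (+ m - + 1))))
AStep-cong n rec≈rec′ -[1+ _ ] = ≈-refl

-- Without function extensionality, <-rec unfolds only up to ≈, via independence
-- of the recursion from the accessibility proof.
A-acc : ∀ n → Acc _<_ n → ℤ → Series
A-acc = Some.wfRec (λ _ → ℤ → Series) (λ n rec → AStep n (λ j j<n → rec {j} j<n))

A-acc-irrelevant : ∀ n (p q : Acc _<_ n) x → A-acc n p x ≈ A-acc n q x
A-acc-irrelevant n (acc rs) (acc rs′) =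
  AStep-cong n (λ j j<n → A-acc-irrelevant j (rs j<n) (rs′ j<n))

A-unfold : ∀ n x → A n x ≈ AStep n (λ j _ → A j) x
A-unfold n = AStep-cong n λ j j<n →
  A-acc-irrelevant j (acc-inverse (<-wellFounded n) j<n) (<-wellFounded j)

ΔA : ℕ → ℤ → ℤ → Series
ΔA j x y = A j x ⊖ A j y

ΔA-split : ∀ j x y z → ΔA j x z ≈ ΔA j x y ⊕ ΔA j y z
ΔA-split j x y z = coeffwise λ m → insert (A j x m) (A j y m) (A j z m)
  where
  insert : ∀ (a b c : ℤ) → a - c ≡ (a - b) + (b - c)
  insert = solve-∀

-- the coefficient c_{N,i} of AStep, with the recursive calls resolved to A
A-increment : ℕ → ℤ → Series
A-increment N i = (δ0 i ⊖ δ i N) ⊖ sumS N (λ j → qbinom N j ⊛ ΔA j (i - + (N ∸ j)) (i - + 1))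

A-+ : ∀ N k → A N (+ k) ≈ sumS (suc k) (λ m → A-increment N (+ m))
A-+ N k = ≈-trans (A-unfold N (+ k)) (sumS-cong (suc k) λ m _ →
  ⊖-cong (≈-refl {δ0 (+ m) ⊖ δ (+ m) N}) (sumFin-toℕ N _))

A-negative : ∀ N k → A N -[1+ k ] ≈ 0S
A-negative N k = A-unfold N -[1+ k ]

A-negative-sub : ∀ N k x → A N (-[1+ k ] - + x) ≈ 0S
A-negative-sub N k zero    = A-negative N k
A-negative-sub N k (suc x) = A-negative N (suc (k ℕ.+ x))

A-increment-negative : ∀ N k → A-increment N -[1+ k ] ≈ 0S
A-increment-negative N k = ⊖-cong (≈-refl {0S ⊖ 0S}) (sumS-zero N λ j _ →
  ≈-trans (⊛-congˡ (qbinom N j) (⊖-cong (A-negative-sub j k (N ∸ j)) (A-negative-sub j k 1)))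
          (⊛-zeroʳ (qbinom N j)))

A-difference : ∀ N i → ΔA N i (i - + 1) ≈ A-increment N i
A-difference N (+ zero)  = ≈-trans (⊖-cong (A-+ N 0) (A-negative N 0))
  (coeffwise λ m → trans (ℤP.+-identityʳ _) (ℤP.+-identityˡ _))
A-difference N (+ suc k) = ≈-trans (⊖-cong (A-+ N (suc k)) (A-+ N k))
  (coeffwise λ m → cancel (sumS (suc k) (λ l → A-increment N (+ l)) m) _)
  where
  cancel : ∀ (a b : ℤ) → (a + b) - a ≡ b
  cancel = solve-∀
A-difference N -[1+ k ]  = ≈-trans (⊖-cong (A-negative N k) (A-negative-sub N k 1))
  (≈-sym (A-increment-negative N k))

A-recurrence : ∀ N i → qbinomSum N (λ j → ΔA j (i - + (N ∸ j)) (i - + 1)) ≈ δ0 i ⊖ δ i N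
A-recurrence N i = begin
    sumS N T ⊕ qbinom N N ⊛ ΔA N (i - + (N ∸ N)) (i - + 1)
  ≈⟨ ⊕-cong (≈-refl {sumS N T}) last-term ⟩
    sumS N T ⊕ ((δ0 i ⊖ δ i N) ⊖ sumS N T)
  ≈⟨ coeffwise (λ m → cancel (sumS N T m) ((δ0 i ⊖ δ i N) m)) ⟩
    δ0 i ⊖ δ i N
  ∎
  where
  T : ℕ → Series
  T j = qbinom N j ⊛ ΔA j (i - + (N ∸ j)) (i - + 1)
  cancel : ∀ (a b : ℤ) → a + (b - a) ≡ b
  cancel = solve-∀
  i-0 : i - + (N ∸ N) ≡ i
  i-0 = trans (cong (λ k → i - + k) (ℕP.n∸n≡0 N)) (ℤP.+-identityʳ i)
  last-term : qbinom N N ⊛ ΔA N (i - + (N ∸ N)) (i - + 1) ≈ A-increment N i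
  last-term = ≈-trans (⊛-cong (qbinom-diag N) (≡⇒≈ (cong (λ x → ΔA N x (i - + 1)) i-0)))
                      (≈-trans (⊛-identityˡ (ΔA N i (i - + 1))) (A-difference N i))

A-recurrence-reversed : ∀ N x → qbinomSum N (λ t → ΔA (N ∸ t) (x - + t) (x - + 1)) ≈ δ0 x ⊖ δ x N
A-recurrence-reversed N x =
  ≈-trans (qbinomSum-reverse N (λ j t → ΔA j (x - + t) (x - + 1))) (A-recurrence N x)

qbinomSum-ΔA : ∀ N x y →
  qbinomSum N (λ t → ΔA (N ∸ t) (x - + t) y) ≈ (δ0 x ⊖ δ x N) ⊕ qbinomSum N (λ j → ΔA j (x - + 1) y)
qbinomSum-ΔA N x y = begin
    qbinomSum N (λ t → ΔA (N ∸ t) (x - + t) y)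
  ≈⟨ qbinomSum-cong N (λ t _ → ΔA-split (N ∸ t) (x - + t) (x - + 1) y) ⟩
    qbinomSum N (λ t → ΔA (N ∸ t) (x - + t) (x - + 1) ⊕ ΔA (N ∸ t) (x - + 1) y)
  ≈⟨ qbinomSum-distrib-⊕ N (λ t → ΔA (N ∸ t) (x - + t) (x - + 1)) (λ t → ΔA (N ∸ t) (x - + 1) y) ⟩
    qbinomSum N (λ t → ΔA (N ∸ t) (x - + t) (x - + 1)) ⊕ qbinomSum N (λ t → ΔA (N ∸ t) (x - + 1) y)
  ≈⟨ ⊕-cong (A-recurrence-reversed N x) (qbinomSum-reverse N (λ j _ → ΔA j (x - + 1) y)) ⟩
    (δ0 x ⊖ δ x N) ⊕ qbinomSum N (λ j → ΔA j (x - + 1) y)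
  ∎

δ0-≢0 : ∀ {z} → z ≢ + 0 → δ0 z ≈ 0S
δ0-≢0 {+ zero}    z≢0 = ⊥-elim (z≢0 refl)
δ0-≢0 {+ suc _}   _   = ≈-refl
δ0-≢0 { -[1+ _ ] } _  = ≈-refl

δ0-sub-≡ : ∀ {z k} → z ≡ + k → δ0 (z - + k) ≈ 1S
δ0-sub-≡ {k = k} refl = ≡⇒≈ (cong δ0 (ℤP.+-inverseʳ (+ k)))

δ0-sub-≢ : ∀ {z k} → z ≢ + k → δ0 (z - + k) ≈ 0S
δ0-sub-≢ {z} {k} z≢k = δ0-≢0 (z≢k ∘ ℤP.i-j≡0⇒i≡j z (+ k))

⊛-δ0-sub-≡ : ∀ f {z k} → z ≡ + k → f ⊛ δ0 (z - + k) ≈ f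
⊛-δ0-sub-≡ f z≡k = ≈-trans (⊛-congˡ f (δ0-sub-≡ z≡k)) (⊛-identityʳ f)

⊛-δ0-sub-≢ : ∀ f {z k} → z ≢ + k → f ⊛ δ0 (z - + k) ≈ 0S
⊛-δ0-sub-≢ f z≢k = ≈-trans (⊛-congˡ f (δ0-sub-≢ z≢k)) (⊛-zeroʳ f)

δ≈δ0-sub : ∀ z k → δ z k ≈ δ0 (z - + k)
δ≈δ0-sub z k with z ℤ.≟ + k
... | yes z≡k = ≈-sym (δ0-sub-≡ z≡k)
... | no  z≢k = ≈-sym (δ0-sub-≢ z≢k)

i-m-[n∸m]≡i-n : ∀ i {m n} → m ≤ n → i - + m - + (n ∸ m) ≡ i - + n
i-m-[n∸m]≡i-n i {m} {n} m≤n =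
  trans (cong (λ x → i - + m - x) (sym (trans (ℤP.[+m]-[+n]≡m⊖n n m) (ℤP.⊖-≥ m≤n))))
        (cancel i (+ m) (+ n))
  where
  cancel : ∀ i x y → i - x - (y - x) ≡ i - y
  cancel = solve-∀

δ-sub-sub : ∀ i {a n} → a ≤ n → δ (i - + a) (n ∸ a) ≈ δ0 (i - + n)
δ-sub-sub i {a} {n} a≤n =
  ≈-trans (δ≈δ0-sub (i - + a) (n ∸ a)) (≡⇒≈ (cong δ0 (i-m-[n∸m]≡i-n i a≤n)))

qbinomSum-δ0 : ∀ n z → qbinomSum n (λ a → δ0 (z - + a)) ≈ qbinomℤ n z
qbinomSum-δ0 n -[1+ k ] = sumS-zero (suc n) (λ s _ → ⊛-δ0-sub-≢ (qbinom n s) { -[1+ k ] } {s} (λ ()))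
qbinomSum-δ0 n (+ t)    = on-range (t ≤? n)
  where
  on-range : Dec (t ≤ n) → qbinomSum n (λ a → δ0 (+ t - + a)) ≈ qbinom n t
  on-range (yes t≤n) = ≈-trans
    (sumS-single (suc n) t (s≤s t≤n) λ s _ s≢t →
      ⊛-δ0-sub-≢ (qbinom n s) (s≢t ∘ sym ∘ ℤP.+-injective))
    (⊛-δ0-sub-≡ (qbinom n t) {k = t} refl)
  on-range (no t≰n) = ≈-trans
    (sumS-zero (suc n) (λ s s<1+n → ⊛-δ0-sub-≢ (qbinom n s) λ t≡s →
      t≰n (subst (_≤ n) (sym (ℤP.+-injective t≡s)) (ℕP.≤-pred s<1+n))))
    (≈-sym (qbinom-> (ℕP.≰⇒> t≰n)))

corr-≈ : ∀ n i → corr n i ≈ H1 n ⊛ δ0 (i - + 1) ⊖ H1 n ⊛ δ0 (i - + n)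
corr-≈ n i with n ℕ.≟ 1
... | yes refl = coeffwise λ m → sym (ℤP.+-inverseʳ ((H1 1 ⊛ δ0 (i - + 1)) m))
... | no  n≢1 with i ℤ.≟ + 1 | i ℤ.≟ + n
...   | yes i≡1 | _       = ≈-sym (≈-trans
          (⊖-cong (⊛-δ0-sub-≡ (H1 n) i≡1)
                  (⊛-δ0-sub-≢ (H1 n) λ i≡n → n≢1 (ℤP.+-injective (trans (sym i≡n) i≡1))))
          (coeffwise λ m → ℤP.+-identityʳ (H1 n m)))
...   | no  i≢1 | yes i≡n = ≈-sym (≈-trans
          (⊖-cong (⊛-δ0-sub-≢ (H1 n) i≢1) (⊛-δ0-sub-≡ (H1 n) i≡n))
          (coeffwise λ m → ℤP.+-identityˡ (- H1 n m)))
...   | no  i≢1 | no  i≢n = ≈-sym (≈-trans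
          (⊖-cong (⊛-δ0-sub-≢ (H1 n) i≢1) (⊛-δ0-sub-≢ (H1 n) i≢n))
          (coeffwise λ _ → refl))

H1-⊛ : ∀ k g f → H1 k ⊛ g ⊛ f ≈ g ⊛ qbinomSum k (λ _ → f)
H1-⊛ k g f = begin
    H1 k ⊛ g ⊛ f                ≈⟨ ⊛-congʳ f (⊛-comm (H1 k) g) ⟩
    g ⊛ H1 k ⊛ f                ≈⟨ ⊛-assoc g (H1 k) f ⟩
    g ⊛ (H1 k ⊛ f)              ≈⟨ ⊛-congˡ g (≈-sym (qbinomSum-const k f)) ⟩
    g ⊛ qbinomSum k (λ _ → f)   ∎

weighted-sum-split : ∀ n i →
  sumS (suc n) (λ k → H1 k ⊛ qbinom n k ⊛ A (n ∸ k) (i - + k))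
    ⊖ sumS (suc n) (λ k → H1 k ⊛ qbinom n k ⊛ A (n ∸ k) (i - + 2))
  ≈ qbinomSum n (λ a → δ0 (i - + a) ⊖ δ (i - + a) (n ∸ a))
    ⊕ qbinomSum n (λ a → qbinomSum (n ∸ a) (λ j → ΔA j (i - + a - + 1) (i - + 2)))
weighted-sum-split n i = begin
    sumS (suc n) (λ k → H1 k ⊛ qbinom n k ⊛ A (n ∸ k) (i - + k))
      ⊖ sumS (suc n) (λ k → H1 k ⊛ qbinom n k ⊛ A (n ∸ k) (i - + 2))
  ≈⟨ ≈-sym (sumS-distrib-⊖ (suc n) _ _) ⟩
    sumS (suc n) (λ k → H1 k ⊛ qbinom n k ⊛ A (n ∸ k) (i - + k)
                          ⊖ H1 k ⊛ qbinom n k ⊛ A (n ∸ k) (i - + 2))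
  ≈⟨ sumS-cong (suc n) (λ k _ → ≈-trans
       (≈-sym (⊛-distribˡ-⊖ (H1 k ⊛ qbinom n k) (A (n ∸ k) (i - + k)) (A (n ∸ k) (i - + 2))))
       (H1-⊛ k (qbinom n k) (ΔA (n ∸ k) (i - + k) (i - + 2)))) ⟩
    qbinomSum n (λ k → qbinomSum k (λ _ → ΔA (n ∸ k) (i - + k) (i - + 2)))
  ≈⟨ qbinomSum-cong n (λ k _ → qbinomSum-cong k λ a a≤k → ≡⇒≈ (cong₂ (λ u v → ΔA u v (i - + 2))
       (sym (m∸n∸[o∸n]≡m∸o n a≤k)) (sym (i-m-[n∸m]≡i-n i a≤k)))) ⟩
    qbinomSum n (λ k → qbinomSum k (λ a → ΔA (n ∸ a ∸ (k ∸ a)) (i - + a - + (k ∸ a)) (i - + 2)))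
  ≈⟨ qbinomSum-nested n (λ a t → ΔA (n ∸ a ∸ t) (i - + a - + t) (i - + 2)) ⟩
    qbinomSum n (λ a → qbinomSum (n ∸ a) (λ t → ΔA (n ∸ a ∸ t) (i - + a - + t) (i - + 2)))
  ≈⟨ qbinomSum-cong n (λ a _ → qbinomSum-ΔA (n ∸ a) (i - + a) (i - + 2)) ⟩
    qbinomSum n (λ a → (δ0 (i - + a) ⊖ δ (i - + a) (n ∸ a))
                       ⊕ qbinomSum (n ∸ a) (λ j → ΔA j (i - + a - + 1) (i - + 2)))
  ≈⟨ qbinomSum-distrib-⊕ n (λ a → δ0 (i - + a) ⊖ δ (i - + a) (n ∸ a))
       (λ a → qbinomSum (n ∸ a) (λ j → ΔA j (i - + a - + 1) (i - + 2))) ⟩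
    qbinomSum n (λ a → δ0 (i - + a) ⊖ δ (i - + a) (n ∸ a))
      ⊕ qbinomSum n (λ a → qbinomSum (n ∸ a) (λ j → ΔA j (i - + a - + 1) (i - + 2)))
  ∎

qbinomSum-boundary : ∀ n i →
  qbinomSum n (λ a → δ0 (i - + a) ⊖ δ (i - + a) (n ∸ a)) ≈ qbinomℤ n i ⊖ H1 n ⊛ δ0 (i - + n)
qbinomSum-boundary n i = begin
    qbinomSum n (λ a → δ0 (i - + a) ⊖ δ (i - + a) (n ∸ a))
  ≈⟨ qbinomSum-cong n (λ a a≤n → ⊖-cong (≈-refl {δ0 (i - + a)}) (δ-sub-sub i a≤n)) ⟩
    qbinomSum n (λ a → δ0 (i - + a) ⊖ δ0 (i - + n))
  ≈⟨ qbinomSum-distrib-⊖ n (λ a → δ0 (i - + a)) (λ _ → δ0 (i - + n)) ⟩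
    qbinomSum n (λ a → δ0 (i - + a)) ⊖ qbinomSum n (λ _ → δ0 (i - + n))
  ≈⟨ ⊖-cong (qbinomSum-δ0 n i) (qbinomSum-const n (δ0 (i - + n))) ⟩
    qbinomℤ n i ⊖ H1 n ⊛ δ0 (i - + n)
  ∎

qbinomSum-shifted : ∀ n i →
  qbinomSum n (λ a → qbinomSum (n ∸ a) (λ j → ΔA j (i - + a - + 1) (i - + 2)))
  ≈ H1 n ⊛ δ0 (i - + 1) ⊖ qbinomℤ n (i - + 1)
qbinomSum-shifted n i = begin
    qbinomSum n (λ a → qbinomSum (n ∸ a) (λ j → ΔA j (i - + a - + 1) (i - + 2)))
  ≈⟨ qbinomSum-cong n (λ a _ → qbinomSum-cong (n ∸ a) λ j _ →
       ≡⇒≈ (cong₂ (ΔA j) (swap-sub i (+ a) (+ 1)) (i-2 i))) ⟩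
    qbinomSum n (λ a → qbinomSum (n ∸ a) (λ j → ΔA j (i′ - + a) (i′ - + 1)))
  ≈⟨ ≈-sym (qbinomSum-nested n (λ a j → ΔA j (i′ - + a) (i′ - + 1))) ⟩
    qbinomSum n (λ s → qbinomSum s (λ a → ΔA (s ∸ a) (i′ - + a) (i′ - + 1)))
  ≈⟨ qbinomSum-cong n (λ s _ →
       ≈-trans (A-recurrence-reversed s i′) (⊖-cong (≈-refl {δ0 i′}) (δ≈δ0-sub i′ s))) ⟩
    qbinomSum n (λ s → δ0 i′ ⊖ δ0 (i′ - + s))
  ≈⟨ qbinomSum-distrib-⊖ n (λ _ → δ0 i′) (λ s → δ0 (i′ - + s)) ⟩
    qbinomSum n (λ _ → δ0 i′) ⊖ qbinomSum n (λ s → δ0 (i′ - + s))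
  ≈⟨ ⊖-cong (qbinomSum-const n (δ0 i′)) (qbinomSum-δ0 n i′) ⟩
    H1 n ⊛ δ0 i′ ⊖ qbinomℤ n i′
  ∎
  where
  i′ : ℤ
  i′ = i - + 1
  swap-sub : ∀ i x y → i - x - y ≡ i - y - x
  swap-sub = solve-∀
  i-2 : ∀ i → i - + 2 ≡ i - + 1 - + 1
  i-2 = solve-∀

mainTheorem3 : (n : ℕ) (i : ℤ) (m : ℕ) →
    (sumS (suc n) (λ k → H1 k ⊛ qbinom n k ⊛ A (n ∸ k) (i - + k))
      ⊖ sumS (suc n) (λ k → H1 k ⊛ qbinom n k ⊛ A (n ∸ k) (i - + 2))) m
    ≡ (qbinomℤ n i ⊖ qbinomℤ n (i - + 1) ⊕ corr n i) m
mainTheorem3 n i = coeff (begin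
    sumS (suc n) (λ k → H1 k ⊛ qbinom n k ⊛ A (n ∸ k) (i - + k))
      ⊖ sumS (suc n) (λ k → H1 k ⊛ qbinom n k ⊛ A (n ∸ k) (i - + 2))
  ≈⟨ weighted-sum-split n i ⟩
    qbinomSum n (λ a → δ0 (i - + a) ⊖ δ (i - + a) (n ∸ a))
      ⊕ qbinomSum n (λ a → qbinomSum (n ∸ a) (λ j → ΔA j (i - + a - + 1) (i - + 2)))
  ≈⟨ ⊕-cong (qbinomSum-boundary n i) (qbinomSum-shifted n i) ⟩
    (qbinomℤ n i ⊖ H1 n ⊛ δ0 (i - + n)) ⊕ (H1 n ⊛ δ0 (i - + 1) ⊖ qbinomℤ n (i - + 1))
  ≈⟨ coeffwise (λ m → regroup (qbinomℤ n i m) ((H1 n ⊛ δ0 (i - + n)) m)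
                              ((H1 n ⊛ δ0 (i - + 1)) m) (qbinomℤ n (i - + 1) m)) ⟩
    qbinomℤ n i ⊖ qbinomℤ n (i - + 1) ⊕ (H1 n ⊛ δ0 (i - + 1) ⊖ H1 n ⊛ δ0 (i - + n))
  ≈⟨ ⊕-cong (≈-refl {qbinomℤ n i ⊖ qbinomℤ n (i - + 1)}) (≈-sym (corr-≈ n i)) ⟩
    qbinomℤ n i ⊖ qbinomℤ n (i - + 1) ⊕ corr n i
  ∎)
  where
  regroup : ∀ (a x y b : ℤ) → (a - x) + (y - b) ≡ (a - b) + (y - x)
  regroup = solve-∀
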